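{- Let $u,v\in\mathcal A_n^*$. If $u\equiv_{\mathrm{knu}}v$ (equivalently, $\mathrm{tab}(u)=\mathrm{tab}(v)$), then $u\equiv_{\mathrm{clk}}v$. Consequently $u\equiv_{\mathrm{clk}}v$ if and only if the row reading words of $\mathrm{tab}(u)$ and $\mathrm{tab}(v)$ are $\equiv_{\mathrm{clk}}$-equivalent.
   Context: $\mathcal A_n=\{a_1<\cdots<a_n\}$, $\mathcal A_n^*$ the free monoid. $\equiv_{\mathrm{knu}}$ is the plactic (Knuth) congruence on $\mathcal A_n^*$ generated by $xzy\equiv zxy$ for letters $x\le y<z$ and $yxz\equiv yzx$ for $x<y\le z$. $\mathrm{tab}(w)$ is the semistandard Young tableau obtained from $w$ by Schensted row insertion; its row reading word is the concatenation of its rows from top row to bottom row, each read left to right. For an interval $J\subseteq\{1,\dots,n\}$, $\mathrm{len}_J(w)$ is the maximal length of a nondecreasing subword of $w$ with letters in $\{a_j:j\in J\}$; $u\equiv_{\mathrm{clk}}v$ iff $\mathrm{len}_J(u)=\mathrm{len}_J(v)$ for all intervals $J$. -}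

module Defs where

open import Data.Nat using (ℕ; _⊔_)
open import Data.Fin using (Fin; _≤_; _<_; _≤?_; _<?_)
open import Data.Bool using (Bool; true; false; _∧_; if_then_else_)
open import Data.List using (List; []; _∷_; _++_; [_]; map; filter; foldr; foldl; length; concat; reverse)
open import Data.Maybe using (Maybe; just; nothing)
open import Data.Product using (_×_; _,_)
open import Relation.Binary.PropositionalEquality using (_≡_)
open import Relation.Nullary.Decidable using (does)
open import Data.Bool.Properties using ()
open import Data.Bool using (T?)


-- The alphabet A_n = {a_1 < ... < a_n} is Fin n (a_{k+1} = k), ordered as Fin.
Word : ℕ → Set
Word n = List (Fin n)

infix 4 _≡knu_
data _≡knu_ {n : ℕ} : Word n → Word n → Set where
  knu-refl  : ∀ {u} → u ≡knu u
  knu-sym   : ∀ {u v} → u ≡knu v → v ≡knu u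
  knu-trans : ∀ {u v w} → u ≡knu v → v ≡knu w → u ≡knu w
  knu-1 : ∀ (p s : Word n) {x y z : Fin n} → x ≤ y → y < z →
          (p ++ (x ∷ z ∷ y ∷ []) ++ s) ≡knu (p ++ (z ∷ x ∷ y ∷ []) ++ s)
  knu-2 : ∀ (p s : Word n) {x y z : Fin n} → x < y → y ≤ z →
          (p ++ (y ∷ x ∷ z ∷ []) ++ s) ≡knu (p ++ (y ∷ z ∷ x ∷ []) ++ s)

-- Tableaux: list of rows, the first row being the one into which letters
-- are inserted (the longest row); each row is read left to right.
Row : ℕ → Set
Row n = List (Fin n)

Tableau : ℕ → Set
Tableau n = List (Row n)

rowInsert : ∀ {n} → Fin n → Row n → Maybe (Fin n) × Row n
rowInsert x [] = nothing , [ x ]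
rowInsert x (y ∷ r) with does (x <? y)
... | true  = just y , x ∷ r
... | false with rowInsert x r
...   | b , r' = b , y ∷ r'

insert : ∀ {n} → Fin n → Tableau n → Tableau n
insert x [] = [ x ] ∷ []
insert x (r ∷ rs) with rowInsert x r
... | nothing , r' = r' ∷ rs
... | just y  , r' = r' ∷ insert y rs

tab : ∀ {n} → Word n → Tableau n
tab w = foldl (λ t x → insert x t) [] w

-- Row reading word: rows concatenated from the shortest (last-created) row
-- to the first row, each read left to right (the paper's "top to bottom",
-- with tableaux drawn in French convention).
reading : ∀ {n} → Tableau n → Word n
reading t = concat (reverse t)

subwords : ∀ {A : Set} → List A → List (List A)
subwords [] = [] ∷ []
subwords (x ∷ xs) = map (x ∷_) (subwords xs) ++ subwords xs

nondecreasing : ∀ {n} → Word n → Bool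
nondecreasing [] = true
nondecreasing (x ∷ []) = true
nondecreasing (x ∷ y ∷ w) = does (x ≤? y) ∧ nondecreasing (y ∷ w)

inInterval : ∀ {n} → Fin n → Fin n → Word n → Bool
inInterval i j [] = true
inInterval i j (x ∷ w) = does (i ≤? x) ∧ does (x ≤? j) ∧ inInterval i j w

maximum : List ℕ → ℕ
maximum = foldr _⊔_ 0

len : ∀ {n} → Fin n → Fin n → Word n → ℕ
len i j w = maximum (map length (filter (λ s → T? (nondecreasing s ∧ inInterval i j s)) (subwords w)))

infix 4 _≡clk_
_≡clk_ : ∀ {n} → Word n → Word n → Set
u ≡clk v = ∀ i j → i ≤ j → len i j u ≡ len i j v

-- A Knuth relation rewrites a three-letter factor only, and a case analysis on which of its
-- letters a nondecreasing subword uses shows that every such subword can be rerouted through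
-- the rewritten factor without changing its length or its alphabet interval J.  The only
-- non-trivial reroutings replace x z by x y (for x z y ≡ z x y) or x z by y z (for
-- y x z ≡ y z x); they stay inside J because x ≤ y ≤ z and J is an interval.  So every len_J
-- is a Knuth invariant.  The second claim follows from w ≡knu reading (tab w): bumping y out of
-- a row r by x is realised on reading words by Knuth moves, r x ≡knu y r'.
module Submission where

open import Defs
open import Data.Nat as ℕ using (ℕ; _+_)
open import Data.Nat.Properties using (<-≤-trans; ≤-<-trans; <⇒≤; <⇒≱; ≮⇒≥; ≤-refl; ≤-trans; ≤-antisym; m≤m⊔n; m≤n⊔m; ⊔-lub)
open import Data.Fin using (Fin; _≤_; _<_; _≤?_; _<?_)
open import Data.Bool using (_∧_; T; T?)
open import Data.Bool.Properties using (T-∧)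
open import Data.List using (List; []; _∷_; _++_; [_]; map; filter; length; foldl; concat; reverse)
open import Data.List.Properties using (++-assoc; ++-identityʳ; unfold-reverse; concat-++; length-++)
open import Data.List.Membership.Propositional using (_∈_)
open import Data.List.Membership.Propositional.Properties using (∈-map⁺; ∈-map⁻; ∈-++⁺ˡ; ∈-++⁺ʳ; ∈-++⁻; ∈-filter⁺; ∈-filter⁻)
open import Data.List.Relation.Unary.Any using (here; there)
open import Data.List.Relation.Unary.All using (All; []; _∷_)
import Data.List.Relation.Unary.All.Properties as All
open import Data.List.Relation.Unary.Linked as Linked using (Linked; []; [-]; _∷_)
open import Data.List.Relation.Binary.Sublist.Propositional using (_⊆_; []; _∷_; _∷ʳ_)
import Data.List.Relation.Binary.Sublist.Propositional.Properties as Sublist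
open import Data.Maybe using (Maybe; just; nothing)
open import Data.Product using (_×_; _,_; proj₁; proj₂; ∃-syntax; ∃₂; uncurry)
import Data.Product as Product
open import Data.Sum using (inj₁; inj₂)
open import Function using (_∘_)
open import Function.Bundles using (_⇔_; mk⇔; Equivalence)
open import Function.Properties.Equivalence using () renaming (trans to ⇔-trans)
open import Data.Product.Function.NonDependent.Propositional using (_×-⇔_)
open import Relation.Binary.Bundles using (Setoid)
import Relation.Binary.Reasoning.Setoid as SetoidReasoning
open import Relation.Binary.PropositionalEquality using (_≡_; refl; sym; trans; cong; subst₂; module ≡-Reasoning)
open import Relation.Nullary using (Dec; yes; no; contradiction)
open import Relation.Nullary.Decidable using (does; dec-true; dec-false)

Sorted : ∀ {n} → Word n → Set
Sorted = Linked _≤_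

Sorted-lowerHead : ∀ {n} {a b : Fin n} {r} → a ≤ b → Sorted (b ∷ r) → Sorted (a ∷ r)
Sorted-lowerHead a≤b [-] = [-]
Sorted-lowerHead a≤b (b≤c ∷ br) = ≤-trans a≤b b≤c ∷ br

module _ {n : ℕ} where

  ≡knu-prefix : ∀ p {u v : Word n} → u ≡knu v → p ++ u ≡knu p ++ v
  ≡knu-prefix p knu-refl = knu-refl
  ≡knu-prefix p (knu-sym e) = knu-sym (≡knu-prefix p e)
  ≡knu-prefix p (knu-trans e f) = knu-trans (≡knu-prefix p e) (≡knu-prefix p f)
  ≡knu-prefix p (knu-1 q s x≤y y<z) =
    subst₂ _≡knu_ (++-assoc p q _) (++-assoc p q _) (knu-1 (p ++ q) s x≤y y<z)
  ≡knu-prefix p (knu-2 q s x<y y≤z) =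
    subst₂ _≡knu_ (++-assoc p q _) (++-assoc p q _) (knu-2 (p ++ q) s x<y y≤z)

  ≡knu-suffix : ∀ s {u v : Word n} → u ≡knu v → u ++ s ≡knu v ++ s
  ≡knu-suffix s knu-refl = knu-refl
  ≡knu-suffix s (knu-sym e) = knu-sym (≡knu-suffix s e)
  ≡knu-suffix s (knu-trans e f) = knu-trans (≡knu-suffix s e) (≡knu-suffix s f)
  ≡knu-suffix s (knu-1 q t x≤y y<z) =
    subst₂ _≡knu_ (sym (++-assoc q _ s)) (sym (++-assoc q _ s)) (knu-1 q (t ++ s) x≤y y<z)
  ≡knu-suffix s (knu-2 q t x<y y≤z) =
    subst₂ _≡knu_ (sym (++-assoc q _ s)) (sym (++-assoc q _ s)) (knu-2 q (t ++ s) x<y y≤z)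

  ≡knu-setoid : Setoid _ _
  ≡knu-setoid = record
    { Carrier = Word n ; _≈_ = _≡knu_
    ; isEquivalence = record { refl = knu-refl ; sym = knu-sym ; trans = knu-trans } }

  slide : ∀ {b x : Fin n} r → x < b → Sorted (b ∷ r) → b ∷ r ++ [ x ] ≡knu b ∷ x ∷ r
  slide [] _ _ = knu-refl
  slide (c ∷ r) x<b (b≤c ∷ cr) =
    knu-trans (≡knu-prefix [ _ ] (slide r (<-≤-trans x<b b≤c) cr)) (knu-sym (knu-2 [] r x<b b≤c))

  rowInsert-Sorted-below : ∀ {c} x (r : Row n) → c ≤ x → Sorted (c ∷ r) → Sorted (c ∷ proj₂ (rowInsert x r))
  rowInsert-Sorted-below x [] c≤x _ = c≤x ∷ [-]
  rowInsert-Sorted-below x (d ∷ r) c≤x (c≤d ∷ dr) with x <? d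
  ... | yes x<d rewrite dec-true (x <? d) x<d = c≤x ∷ Sorted-lowerHead (<⇒≤ x<d) dr
  ... | no x≮d rewrite dec-false (x <? d) x≮d
    with rowInsert x r | rowInsert-Sorted-below x r (≮⇒≥ x≮d) dr
  ...   | _ , r' | dr' = c≤d ∷ dr'

  rowInsert-Sorted : ∀ x (r : Row n) → Sorted r → Sorted (proj₂ (rowInsert x r))
  rowInsert-Sorted x [] _ = [-]
  rowInsert-Sorted x (d ∷ r) dr with x <? d
  ... | yes x<d rewrite dec-true (x <? d) x<d = Sorted-lowerHead (<⇒≤ x<d) dr
  ... | no x≮d rewrite dec-false (x <? d) x≮d
    with rowInsert x r | rowInsert-Sorted-below x r (≮⇒≥ x≮d) dr
  ...   | _ , r' | dr' = dr'

  data RowInsertion (x : Fin n) (r : Row n) : Maybe (Fin n) × Row n → Set where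
    appended : RowInsertion x r (nothing , r ++ [ x ])
    bumped   : ∀ {y h t} → r ++ [ x ] ≡knu y ∷ h ∷ t → x < y → h ≤ x → RowInsertion x r (just y , h ∷ t)

  rowInsertion : ∀ x (r : Row n) → Sorted r → RowInsertion x r (rowInsert x r)
  rowInsertion x [] _ = appended
  rowInsertion x (d ∷ r) dr with x <? d
  ... | yes x<d rewrite dec-true (x <? d) x<d = bumped (slide r x<d dr) x<d ≤-refl
  ... | no x≮d rewrite dec-false (x <? d) x≮d
    with rowInsert x r | rowInsertion x r (Linked.tail dr) | rowInsert-Sorted-below x r (≮⇒≥ x≮d) dr
  ...   | _ | appended | _ = appended
  ...   | _ | bumped {t = t} e x<y h≤x | d≤h ∷ _ =
          bumped (knu-trans (≡knu-prefix [ d ] e) (knu-1 [] t d≤h (≤-<-trans h≤x x<y))) x<y (≮⇒≥ x≮d)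

  insert-Sorted : ∀ x (t : Tableau n) → All Sorted t → All Sorted (insert x t)
  insert-Sorted x [] _ = [-] ∷ []
  insert-Sorted x (r ∷ rs) (sr ∷ srs) with rowInsert x r | rowInsert-Sorted x r sr
  ... | nothing , _ | sr' = sr' ∷ srs
  ... | just y  , _ | sr' = sr' ∷ insert-Sorted y rs srs

  reading-∷ : ∀ (r : Row n) rs → reading (r ∷ rs) ≡ reading rs ++ r
  reading-∷ r rs = begin
    concat (reverse (r ∷ rs))       ≡⟨ cong concat (unfold-reverse r rs) ⟩
    concat (reverse rs ++ [ r ])    ≡⟨ concat-++ (reverse rs) [ r ] ⟨
    reading rs ++ concat [ r ]      ≡⟨ cong (reading rs ++_) (++-identityʳ r) ⟩
    reading rs ++ r                 ∎
    where open ≡-Reasoning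

  insert-reading : ∀ x (t : Tableau n) → All Sorted t → reading (insert x t) ≡knu reading t ++ [ x ]
  insert-reading x [] _ = knu-refl
  insert-reading x (r ∷ rs) (sr ∷ srs) with rowInsert x r | rowInsertion x r sr
  ... | _ | appended = begin
    reading ((r ++ [ x ]) ∷ rs) ≡⟨ reading-∷ _ rs ⟩
    reading rs ++ r ++ [ x ]    ≡⟨ ++-assoc (reading rs) r [ x ] ⟨
    (reading rs ++ r) ++ [ x ]  ≡⟨ cong (_++ [ x ]) (reading-∷ r rs) ⟨
    reading (r ∷ rs) ++ [ x ]   ∎
    where open SetoidReasoning ≡knu-setoid
  ... | _ | bumped {y} {h} {t} r·x≡y·h·t _ _ = begin
    reading ((h ∷ t) ∷ insert y rs)   ≡⟨ reading-∷ _ (insert y rs) ⟩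
    reading (insert y rs) ++ h ∷ t    ≈⟨ ≡knu-suffix (h ∷ t) (insert-reading y rs srs) ⟩
    (reading rs ++ [ y ]) ++ h ∷ t    ≡⟨ ++-assoc (reading rs) [ y ] (h ∷ t) ⟩
    reading rs ++ y ∷ h ∷ t           ≈⟨ ≡knu-prefix (reading rs) r·x≡y·h·t ⟨
    reading rs ++ r ++ [ x ]          ≡⟨ ++-assoc (reading rs) r [ x ] ⟨
    (reading rs ++ r) ++ [ x ]        ≡⟨ cong (_++ [ x ]) (reading-∷ r rs) ⟨
    reading (r ∷ rs) ++ [ x ]         ∎
    where open SetoidReasoning ≡knu-setoid

  foldl-insert-reading : ∀ (t : Tableau n) → All Sorted t → ∀ w →
    reading t ++ w ≡knu reading (foldl (λ t x → insert x t) t w)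
  foldl-insert-reading t st [] = Setoid.reflexive ≡knu-setoid (++-identityʳ (reading t))
  foldl-insert-reading t st (x ∷ w) = begin
    reading t ++ x ∷ w              ≡⟨ ++-assoc (reading t) [ x ] w ⟨
    (reading t ++ [ x ]) ++ w       ≈⟨ ≡knu-suffix w (insert-reading x t st) ⟨
    reading (insert x t) ++ w       ≈⟨ foldl-insert-reading (insert x t) (insert-Sorted x t st) w ⟩
    reading (foldl (λ t x → insert x t) (insert x t) w) ∎
    where open SetoidReasoning ≡knu-setoid

  ≡knu-reading-tab : ∀ (w : Word n) → w ≡knu reading (tab w)
  ≡knu-reading-tab = foldl-insert-reading [] []

⊆-++-split : ∀ {A : Set} (p : List A) {w s} → s ⊆ p ++ w →
             ∃₂ λ s₁ s₂ → s ≡ s₁ ++ s₂ × s₁ ⊆ p × s₂ ⊆ w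
⊆-++-split [] τ = [] , _ , refl , [] , τ
⊆-++-split (x ∷ p) (refl ∷ τ) with ⊆-++-split p τ
... | s₁ , s₂ , refl , τ₁ , τ₂ = x ∷ s₁ , s₂ , refl , refl ∷ τ₁ , τ₂
⊆-++-split (x ∷ p) (.x ∷ʳ τ) with ⊆-++-split p τ
... | s₁ , s₂ , refl , τ₁ , τ₂ = s₁ , s₂ , refl , x ∷ʳ τ₁ , τ₂

∈-subwords⁻ : ∀ {A : Set} (w : List A) {s} → s ∈ subwords w → s ⊆ w
∈-subwords⁻ [] (here refl) = []
∈-subwords⁻ (x ∷ w) s∈ with ∈-++⁻ (map (x ∷_) (subwords w)) s∈
... | inj₁ s∈keep with ∈-map⁻ (x ∷_) s∈keep
...   | _ , s'∈ , refl = refl ∷ ∈-subwords⁻ w s'∈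
∈-subwords⁻ (x ∷ w) s∈ | inj₂ s∈skip = x ∷ʳ ∈-subwords⁻ w s∈skip

∈-subwords⁺ : ∀ {A : Set} {s w : List A} → s ⊆ w → s ∈ subwords w
∈-subwords⁺ [] = here refl
∈-subwords⁺ (refl ∷ τ) = ∈-++⁺ˡ (∈-map⁺ (_ ∷_) (∈-subwords⁺ τ))
∈-subwords⁺ {w = x ∷ w} (.x ∷ʳ τ) = ∈-++⁺ʳ (map (x ∷_) (subwords w)) (∈-subwords⁺ τ)

length-++-infix : ∀ {A : Set} (s₁ : List A) {t t'} s₂ → length t ≡ length t' →
                  length (s₁ ++ t ++ s₂) ≡ length (s₁ ++ t' ++ s₂)
length-++-infix [] {t} {t'} s₂ eq = begin
  length (t ++ s₂)         ≡⟨ length-++ t ⟩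
  length t + length s₂     ≡⟨ cong (_+ length s₂) eq ⟩
  length t' + length s₂    ≡⟨ length-++ t' ⟨
  length (t' ++ s₂)        ∎
  where open ≡-Reasoning
length-++-infix (x ∷ s₁) s₂ eq = cong ℕ.suc (length-++-infix s₁ s₂ eq)

≤-maximum : ∀ {k xs} → k ∈ xs → k ℕ.≤ maximum xs
≤-maximum {xs = x ∷ _} (here refl) = m≤m⊔n x _
≤-maximum {xs = x ∷ _} (there k∈) = ≤-trans (≤-maximum k∈) (m≤n⊔m x _)

maximum-least : ∀ {m} xs → (∀ {k} → k ∈ xs → k ℕ.≤ m) → maximum xs ℕ.≤ m
maximum-least [] _ = ℕ.z≤n
maximum-least (x ∷ xs) bound = ⊔-lub (bound (here refl)) (maximum-least xs (bound ∘ there))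

Sorted-squeeze : ∀ {n} (s₁ : Word n) {a b c s₂} → a ≤ c → c ≤ b → Sorted (s₁ ++ a ∷ b ∷ s₂) →
                 Sorted (s₁ ++ a ∷ c ∷ s₂) × Sorted (s₁ ++ c ∷ b ∷ s₂)
Sorted-squeeze [] a≤c c≤b (_ ∷ bs) = a≤c ∷ Sorted-lowerHead c≤b bs , c≤b ∷ bs
Sorted-squeeze (d ∷ []) a≤c c≤b (d≤a ∷ abs) =
  Product.map (d≤a ∷_) (≤-trans d≤a a≤c ∷_) (Sorted-squeeze [] a≤c c≤b abs)
Sorted-squeeze (d ∷ e ∷ s₁) a≤c c≤b (d≤e ∷ es) =
  Product.map (d≤e ∷_) (d≤e ∷_) (Sorted-squeeze (e ∷ s₁) a≤c c≤b es)

Sorted-infix : ∀ {n} (s₁ t : Word n) {s₂} → Sorted (s₁ ++ t ++ s₂) → Sorted t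
Sorted-infix [] [] _ = []
Sorted-infix [] (x ∷ []) _ = [-]
Sorted-infix [] (x ∷ y ∷ t) (x≤y ∷ rest) = x≤y ∷ Sorted-infix [] (y ∷ t) rest
Sorted-infix (x ∷ s₁) t sorted = Sorted-infix s₁ t (Linked.tail sorted)

T-does : ∀ {P : Set} (d : Dec P) → T (does d) ⇔ P
T-does (yes p) = mk⇔ (λ _ → p) (λ _ → _)
T-does (no ¬p) = mk⇔ (λ ()) ¬p

T-nondecreasing : ∀ {n} (s : Word n) → T (nondecreasing s) ⇔ Sorted s
T-nondecreasing [] = mk⇔ (λ _ → []) _
T-nondecreasing (x ∷ []) = mk⇔ (λ _ → [-]) _
T-nondecreasing (x ∷ y ∷ s) =
  ⇔-trans T-∧ (⇔-trans (T-does (x ≤? y) ×-⇔ T-nondecreasing (y ∷ s))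
                       (mk⇔ (uncurry _∷_) (λ xys → Linked.head xys , Linked.tail xys)))

module _ {n : ℕ} (i j : Fin n) where

  InInterval : Fin n → Set
  InInterval a = i ≤ a × a ≤ j

  T-inInterval : ∀ (s : Word n) → T (inInterval i j s) ⇔ All InInterval s
  T-inInterval [] = mk⇔ (λ _ → []) _
  T-inInterval (x ∷ s) =
    ⇔-trans T-∧ (⇔-trans (T-does (i ≤? x) ×-⇔ ⇔-trans T-∧ (T-does (x ≤? j) ×-⇔ T-inInterval s))
                         (mk⇔ (λ (i≤x , x≤j , all) → (i≤x , x≤j) ∷ all)
                              (λ { ((i≤x , x≤j) ∷ all) → i≤x , x≤j , all })))

  Chain : Word n → Set
  Chain s = Sorted s × All InInterval s

  T-chain : ∀ s → T (nondecreasing s ∧ inInterval i j s) ⇔ Chain s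
  T-chain s = ⇔-trans T-∧ (T-nondecreasing s ×-⇔ T-inInterval s)

  len≤len : ∀ {w v : Word n} →
            (∀ {s} → s ⊆ w → Chain s → ∃[ s' ] s' ⊆ v × Chain s' × length s ≡ length s') →
            len i j w ℕ.≤ len i j v
  len≤len {w} {v} reroute = maximum-least _ bound
    where
    chain? : ∀ s → Dec (T (nondecreasing s ∧ inInterval i j s))
    chain? s = T? (nondecreasing s ∧ inInterval i j s)

    bound : ∀ {k} → k ∈ map length (filter chain? (subwords w)) → k ℕ.≤ len i j v
    bound k∈ with ∈-map⁻ length k∈
    ... | s , s∈ , refl with ∈-filter⁻ chain? s∈
    ...   | s∈subwords , chain with reroute (∈-subwords⁻ w s∈subwords) (Equivalence.to (T-chain s) chain)
    ...     | s' , τ' , chain' , |s|≡|s'| rewrite |s|≡|s'| =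
              ≤-maximum (∈-map⁺ length (∈-filter⁺ chain? (∈-subwords⁺ τ') (Equivalence.from (T-chain s') chain')))

  Exchangeable : Word n → Word n → Set
  Exchangeable m m' = ∀ s₁ t s₂ → t ⊆ m → Chain (s₁ ++ t ++ s₂) →
                      ∃[ t' ] t' ⊆ m' × length t ≡ length t' × Chain (s₁ ++ t' ++ s₂)

  len-infix-≤ : ∀ p q {m m'} → Exchangeable m m' → len i j (p ++ m ++ q) ℕ.≤ len i j (p ++ m' ++ q)
  len-infix-≤ p q {m} {m'} exchange = len≤len reroute
    where
    reroute : ∀ {s} → s ⊆ p ++ m ++ q → Chain s → ∃[ s' ] s' ⊆ p ++ m' ++ q × Chain s' × length s ≡ length s'
    reroute τ chain with ⊆-++-split p τ
    ... | s₁ , _ , refl , τ₁ , τ₂ with ⊆-++-split m τ₂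
    ...   | t , s₂ , refl , τₜ , τ₃ with exchange s₁ t s₂ τₜ chain
    ...     | t' , τₜ' , |t|≡|t'| , chain' =
              s₁ ++ t' ++ s₂ , Sublist.++⁺ τ₁ (Sublist.++⁺ τₜ' τ₃) , chain' , length-++-infix s₁ s₂ |t|≡|t'|

  Chain-squeeze : ∀ s₁ {a b c s₂} → a ≤ c → c ≤ b → Chain (s₁ ++ a ∷ b ∷ s₂) →
                  Chain (s₁ ++ a ∷ c ∷ s₂) × Chain (s₁ ++ c ∷ b ∷ s₂)
  Chain-squeeze s₁ a≤c c≤b (sorted , inJ) with All.++⁻ s₁ inJ | Sorted-squeeze s₁ a≤c c≤b sorted
  ... | in₁ , a∈J@(i≤a , _) ∷ b∈J@(_ , b≤j) ∷ in₂ | sortedᵃᶜ , sortedᶜᵇ =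
    (sortedᵃᶜ , All.++⁺ in₁ (a∈J ∷ c∈J ∷ in₂)) , (sortedᶜᵇ , All.++⁺ in₁ (c∈J ∷ b∈J ∷ in₂))
    where
    c∈J : InInterval _
    c∈J = ≤-trans i≤a a≤c , ≤-trans c≤b b≤j

  exchange-knu₁ : ∀ {x y z} → x ≤ y → y < z → Exchangeable (x ∷ z ∷ y ∷ []) (z ∷ x ∷ y ∷ [])
  exchange-knu₁ x≤y y<z s₁ t s₂ (refl ∷ refl ∷ refl ∷ []) (sorted , _)
    with Sorted-infix s₁ t sorted
  ... | _ ∷ z≤y ∷ [-] = contradiction z≤y (<⇒≱ y<z)
  exchange-knu₁ x≤y y<z s₁ _ s₂ (refl ∷ refl ∷ _ ∷ʳ []) chain =
    _ , _ ∷ʳ refl ∷ refl ∷ [] , refl , proj₁ (Chain-squeeze s₁ x≤y (<⇒≤ y<z) chain)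
  exchange-knu₁ x≤y y<z s₁ _ s₂ (refl ∷ _ ∷ʳ refl ∷ []) chain = _ , _ ∷ʳ refl ∷ refl ∷ [] , refl , chain
  exchange-knu₁ x≤y y<z s₁ _ s₂ (refl ∷ _ ∷ʳ _ ∷ʳ []) chain = _ , _ ∷ʳ refl ∷ _ ∷ʳ [] , refl , chain
  exchange-knu₁ x≤y y<z s₁ t s₂ (_ ∷ʳ refl ∷ refl ∷ []) (sorted , _)
    with Sorted-infix s₁ t sorted
  ... | z≤y ∷ [-] = contradiction z≤y (<⇒≱ y<z)
  exchange-knu₁ x≤y y<z s₁ _ s₂ (_ ∷ʳ refl ∷ _ ∷ʳ []) chain = _ , refl ∷ _ ∷ʳ _ ∷ʳ [] , refl , chain
  exchange-knu₁ x≤y y<z s₁ _ s₂ (_ ∷ʳ _ ∷ʳ refl ∷ []) chain = _ , _ ∷ʳ _ ∷ʳ refl ∷ [] , refl , chain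
  exchange-knu₁ x≤y y<z s₁ _ s₂ (_ ∷ʳ _ ∷ʳ _ ∷ʳ []) chain = _ , _ ∷ʳ _ ∷ʳ _ ∷ʳ [] , refl , chain

  exchange-knu₁-sym : ∀ {x y z} → x ≤ y → y < z → Exchangeable (z ∷ x ∷ y ∷ []) (x ∷ z ∷ y ∷ [])
  exchange-knu₁-sym x≤y y<z s₁ t s₂ (refl ∷ refl ∷ refl ∷ []) (sorted , _)
    with Sorted-infix s₁ t sorted
  ... | z≤x ∷ _ ∷ [-] = contradiction z≤x (<⇒≱ (≤-<-trans x≤y y<z))
  exchange-knu₁-sym x≤y y<z s₁ t s₂ (refl ∷ refl ∷ _ ∷ʳ []) (sorted , _)
    with Sorted-infix s₁ t sorted
  ... | z≤x ∷ [-] = contradiction z≤x (<⇒≱ (≤-<-trans x≤y y<z))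
  exchange-knu₁-sym x≤y y<z s₁ t s₂ (refl ∷ _ ∷ʳ refl ∷ []) (sorted , _)
    with Sorted-infix s₁ t sorted
  ... | z≤y ∷ [-] = contradiction z≤y (<⇒≱ y<z)
  exchange-knu₁-sym x≤y y<z s₁ _ s₂ (refl ∷ _ ∷ʳ _ ∷ʳ []) chain = _ , _ ∷ʳ refl ∷ _ ∷ʳ [] , refl , chain
  exchange-knu₁-sym x≤y y<z s₁ _ s₂ (_ ∷ʳ refl ∷ refl ∷ []) chain = _ , refl ∷ _ ∷ʳ refl ∷ [] , refl , chain
  exchange-knu₁-sym x≤y y<z s₁ _ s₂ (_ ∷ʳ refl ∷ _ ∷ʳ []) chain = _ , refl ∷ _ ∷ʳ _ ∷ʳ [] , refl , chain
  exchange-knu₁-sym x≤y y<z s₁ _ s₂ (_ ∷ʳ _ ∷ʳ refl ∷ []) chain = _ , _ ∷ʳ _ ∷ʳ refl ∷ [] , refl , chain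
  exchange-knu₁-sym x≤y y<z s₁ _ s₂ (_ ∷ʳ _ ∷ʳ _ ∷ʳ []) chain = _ , _ ∷ʳ _ ∷ʳ _ ∷ʳ [] , refl , chain

  exchange-knu₂ : ∀ {x y z} → x < y → y ≤ z → Exchangeable (y ∷ x ∷ z ∷ []) (y ∷ z ∷ x ∷ [])
  exchange-knu₂ x<y y≤z s₁ t s₂ (refl ∷ refl ∷ refl ∷ []) (sorted , _)
    with Sorted-infix s₁ t sorted
  ... | y≤x ∷ _ ∷ [-] = contradiction y≤x (<⇒≱ x<y)
  exchange-knu₂ x<y y≤z s₁ t s₂ (refl ∷ refl ∷ _ ∷ʳ []) (sorted , _)
    with Sorted-infix s₁ t sorted
  ... | y≤x ∷ [-] = contradiction y≤x (<⇒≱ x<y)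
  exchange-knu₂ x<y y≤z s₁ _ s₂ (refl ∷ _ ∷ʳ refl ∷ []) chain = _ , refl ∷ refl ∷ _ ∷ʳ [] , refl , chain
  exchange-knu₂ x<y y≤z s₁ _ s₂ (refl ∷ _ ∷ʳ _ ∷ʳ []) chain = _ , refl ∷ _ ∷ʳ _ ∷ʳ [] , refl , chain
  exchange-knu₂ x<y y≤z s₁ _ s₂ (_ ∷ʳ refl ∷ refl ∷ []) chain =
    _ , refl ∷ refl ∷ _ ∷ʳ [] , refl , proj₂ (Chain-squeeze s₁ (<⇒≤ x<y) y≤z chain)
  exchange-knu₂ x<y y≤z s₁ _ s₂ (_ ∷ʳ refl ∷ _ ∷ʳ []) chain = _ , _ ∷ʳ _ ∷ʳ refl ∷ [] , refl , chain
  exchange-knu₂ x<y y≤z s₁ _ s₂ (_ ∷ʳ _ ∷ʳ refl ∷ []) chain = _ , _ ∷ʳ refl ∷ _ ∷ʳ [] , refl , chain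
  exchange-knu₂ x<y y≤z s₁ _ s₂ (_ ∷ʳ _ ∷ʳ _ ∷ʳ []) chain = _ , _ ∷ʳ _ ∷ʳ _ ∷ʳ [] , refl , chain

  exchange-knu₂-sym : ∀ {x y z} → x < y → y ≤ z → Exchangeable (y ∷ z ∷ x ∷ []) (y ∷ x ∷ z ∷ [])
  exchange-knu₂-sym x<y y≤z s₁ t s₂ (refl ∷ refl ∷ refl ∷ []) (sorted , _)
    with Sorted-infix s₁ t sorted
  ... | _ ∷ z≤x ∷ [-] = contradiction z≤x (<⇒≱ (<-≤-trans x<y y≤z))
  exchange-knu₂-sym x<y y≤z s₁ _ s₂ (refl ∷ refl ∷ _ ∷ʳ []) chain = _ , refl ∷ _ ∷ʳ refl ∷ [] , refl , chain
  exchange-knu₂-sym x<y y≤z s₁ t s₂ (refl ∷ _ ∷ʳ refl ∷ []) (sorted , _)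
    with Sorted-infix s₁ t sorted
  ... | y≤x ∷ [-] = contradiction y≤x (<⇒≱ x<y)
  exchange-knu₂-sym x<y y≤z s₁ _ s₂ (refl ∷ _ ∷ʳ _ ∷ʳ []) chain = _ , refl ∷ _ ∷ʳ _ ∷ʳ [] , refl , chain
  exchange-knu₂-sym x<y y≤z s₁ t s₂ (_ ∷ʳ refl ∷ refl ∷ []) (sorted , _)
    with Sorted-infix s₁ t sorted
  ... | z≤x ∷ [-] = contradiction z≤x (<⇒≱ (<-≤-trans x<y y≤z))
  exchange-knu₂-sym x<y y≤z s₁ _ s₂ (_ ∷ʳ refl ∷ _ ∷ʳ []) chain = _ , _ ∷ʳ _ ∷ʳ refl ∷ [] , refl , chain
  exchange-knu₂-sym x<y y≤z s₁ _ s₂ (_ ∷ʳ _ ∷ʳ refl ∷ []) chain = _ , _ ∷ʳ refl ∷ _ ∷ʳ [] , refl , chain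
  exchange-knu₂-sym x<y y≤z s₁ _ s₂ (_ ∷ʳ _ ∷ʳ _ ∷ʳ []) chain = _ , _ ∷ʳ _ ∷ʳ _ ∷ʳ [] , refl , chain

  ≡knu⇒len≡ : ∀ {u v : Word n} → u ≡knu v → len i j u ≡ len i j v
  ≡knu⇒len≡ knu-refl = refl
  ≡knu⇒len≡ (knu-sym e) = sym (≡knu⇒len≡ e)
  ≡knu⇒len≡ (knu-trans e f) = trans (≡knu⇒len≡ e) (≡knu⇒len≡ f)
  ≡knu⇒len≡ (knu-1 p s x≤y y<z) =
    ≤-antisym (len-infix-≤ p s (exchange-knu₁ x≤y y<z)) (len-infix-≤ p s (exchange-knu₁-sym x≤y y<z))
  ≡knu⇒len≡ (knu-2 p s x<y y≤z) =
    ≤-antisym (len-infix-≤ p s (exchange-knu₂ x<y y≤z)) (len-infix-≤ p s (exchange-knu₂-sym x<y y≤z))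

≡knu⇒≡clk : ∀ {n} {u v : Word n} → u ≡knu v → u ≡clk v
≡knu⇒≡clk u≡v i j _ = ≡knu⇒len≡ i j u≡v

≡clk-resp-≡knu : ∀ {n} {u u' v v' : Word n} → u ≡knu u' → v ≡knu v' → (u ≡clk v ⇔ u' ≡clk v')
≡clk-resp-≡knu u≡u' v≡v' = mk⇔
  (λ u≈v i j i≤j → trans (≡knu⇒≡clk (knu-sym u≡u') i j i≤j) (trans (u≈v i j i≤j) (≡knu⇒≡clk v≡v' i j i≤j)))
  (λ u'≈v' i j i≤j → trans (≡knu⇒≡clk u≡u' i j i≤j) (trans (u'≈v' i j i≤j) (≡knu⇒≡clk (knu-sym v≡v') i j i≤j)))

proposition6p9 : ∀ (n : ℕ) (u v : Word n) →
    (u ≡knu v → u ≡clk v) × (u ≡clk v ⇔ reading (tab u) ≡clk reading (tab v))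
proposition6p9 n u v = ≡knu⇒≡clk , ≡clk-resp-≡knu (≡knu-reading-tab u) (≡knu-reading-tab v)
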